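{- Let $(A,+)$ be an abelian group, let $\alpha,\beta\in A$, and for a matching $M$ put $s_{\alpha,\beta}(M)=cr(M)\alpha+ne(M)\beta\in A$. Let $n\ge 0$ and let $M,N\in\mathcal{M}(n)$ be two (not necessarily distinct) matchings. 1. If $s_{\alpha,\beta}(\mathcal{T}(M,l))=s_{\alpha,\beta}(\mathcal{T}(N,l))$ for $l=0,1$, then $s_{\alpha,\beta}(\mathcal{T}(M,l))=s_{\alpha,\beta}(\mathcal{T}(N,l))$ for all $l\ge 0$. 2. If $s_{\alpha,\beta}(\mathcal{T}(M,l))=s_{\beta,\alpha}(\mathcal{T}(N,l))$ for $l=0,1$, then $s_{\alpha,\beta}(\mathcal{T}(M,l))=s_{\beta,\alpha}(\mathcal{T}(N,l))$ for all $l\ge 0$. Here all equalities are equalities of multisets.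
   Context: A matching on $[2n]=\{1,\dots,2n\}$ is a partition of $[2n]$ into $n$ two-element blocks (edges); $\mathcal{M}(n)$ is the set of matchings on $[2n]$, with $\mathcal{M}(0)=\{\emptyset\}$. Two distinct edges $A,B$ cross if $\min A<\min B<\max A<\max B$ or vice versa with $A,B$ swapped; they are nested if $\min A<\min B<\max B<\max A$ or vice versa. $cr(M)$ and $ne(M)$ denote the numbers of crossing pairs and of nested pairs of edges of $M$. For $M\in\mathcal{M}(n)$, a child of $M$ is any matching in $\mathcal{M}(n+1)$ obtained by choosing $x\in\{2,\dots,2n+2\}$, relabeling the vertices of $M$ order-preservingly by $\{2,\dots,2n+2\}\setminus\{x\}$, and adding the edge $\{1,x\}$ (adding a new first edge). $\mathcal{T}(M,0)=\{M\}$ and $\mathcal{T}(M,l+1)$ is the set of all children of members of $\mathcal{T}(M,l)$; equivalently $\mathcal{T}(M,l)$ is the set of $N\in\mathcal{M}(n+l)$ whose last $n$ edges (edges ordered by their smaller elements) form a matching order-isomorphic to $M$. For a function $f$ and a set $Z$, $f(Z)$ denotes the multiset of values $f(z)$, $z\in Z$, each value counted with the number of $z\in Z$ attaining it. -}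

module Defs where

open import Level using (Level)
open import Data.Bool using (Bool; true; false; if_then_else_; _∨_; _∧_)
open import Data.Nat using (ℕ; zero; suc; _+_; _*_; _<_; _<ᵇ_)
import Data.Nat.Properties as ℕP
open import Data.Product using (_×_; _,_; proj₁; proj₂)
import Data.Product.Properties as ×P
open import Data.List using (List; []; _∷_; map; concatMap; upTo; deduplicate)
import Data.List.Properties as LP
open import Data.List.Relation.Unary.All using (All)
open import Data.List.Relation.Unary.Linked using (Linked)
open import Data.List.Relation.Binary.Permutation.Propositional using (_↭_)
open import Relation.Binary.Definitions using (DecidableEquality)
open import Algebra.Bundles using (AbelianGroup)
import Algebra.Definitions.RawMonoid as RM
import Data.List.Relation.Binary.Permutation.Setoid as PermS

-- Matchings.
-- An edge {a,b} with a < b is represented by the pair (a , b).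
-- A matching is represented canonically by the list of its edges,
-- ordered by their smaller elements.

Edge : Set
Edge = ℕ × ℕ

Matching : Set
Matching = List Edge

vertices : Matching → List ℕ
vertices = concatMap (λ e → proj₁ e ∷ proj₂ e ∷ [])

range2n : ℕ → List ℕ
range2n n = map suc (upTo (2 * n))

IsMatching : ℕ → Matching → Set
IsMatching n M =
  All (λ e → proj₁ e < proj₂ e) M ×
  Linked (λ e f → proj₁ e < proj₁ f) M ×
  (vertices M ↭ range2n n)

crossesᵇ : Edge → Edge → Bool
crossesᵇ (a , b) (c , d) =
  ((a <ᵇ c) ∧ (c <ᵇ b) ∧ (b <ᵇ d)) ∨ ((c <ᵇ a) ∧ (a <ᵇ d) ∧ (d <ᵇ b))

nestedᵇ : Edge → Edge → Bool
nestedᵇ (a , b) (c , d) =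
  ((a <ᵇ c) ∧ (c <ᵇ d) ∧ (d <ᵇ b)) ∨ ((c <ᵇ a) ∧ (a <ᵇ b) ∧ (b <ᵇ d))

count : {A : Set} → (A → Bool) → List A → ℕ
count p [] = 0
count p (x ∷ xs) = (if p x then 1 else 0) + count p xs

pairCount : (Edge → Edge → Bool) → Matching → ℕ
pairCount R [] = 0
pairCount R (e ∷ es) = count (R e) es + pairCount R es

cr : Matching → ℕ
cr = pairCount crossesᵇ

ne : Matching → ℕ
ne = pairCount nestedᵇ

-- order-preserving relabelling of [2n] onto {2,…,2n+2} ∖ {x}
relabel : ℕ → ℕ → ℕ
relabel x v = if suc v <ᵇ x then suc v else suc (suc v)

child : ℕ → Matching → Matching
child x M = (1 , x) ∷ map (λ e → relabel x (proj₁ e) , relabel x (proj₂ e)) M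

children : ℕ → Matching → List Matching
children n M = map (λ x → child x M) (map (2 +_) (upTo (2 * n + 1)))

_≟M_ : DecidableEquality Matching
_≟M_ = LP.≡-dec (×P.≡-dec ℕP._≟_ ℕP._≟_)

-- 𝓣(M,l) for M ∈ 𝓜(n), as a duplicate-free list (a finite set)
𝓣 : ℕ → Matching → ℕ → List Matching
𝓣 n M zero = M ∷ []
𝓣 n M (suc l) = deduplicate _≟M_ (concatMap (children (n + l)) (𝓣 n M l))

module _ {c ℓ : Level} (G : AbelianGroup c ℓ) where
  open AbelianGroup G
  open RM rawMonoid using () renaming (_×_ to _·_)

  s : Carrier → Carrier → Matching → Carrier
  s α β M = (cr M · α) ∙ (ne M · β)

  -- f(Z) as a multiset: the list of values (with multiplicity)
  sImage : Carrier → Carrier → List Matching → List Carrier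
  sImage α β Z = map (s α β) Z

  _≡ₘ_ : List Carrier → List Carrier → Set (c Level.⊔ ℓ)
  _≡ₘ_ = PermS._↭_ setoid

module Submission where

-- For M ∈ 𝓜(n) and a gap k ∈ {0, …, 2n} put f k = spanning k M · α ∙ closedBy k M · β. The child of M
-- with new edge {1, k + 2} has statistic s(M) ∙ f k, and its gap weights are
-- ε, α ∙ f 0, …, α ∙ f k, β ∙ f k, …, β ∙ f 2n. So the hypotheses for l = 0, 1 imply that
-- s(M) = s(N) and that M and N have the same multiset L of gap weights, and it remains to see that
-- s(𝓣(M,l)) is s(M) shifted by a multiset depending on L only. Let hₜ(L) be the multiset of sums of
-- the size-t submultisets of L. Summed over the children, the pivot identity
--   ⋃ₖ f k ∙ (hₐ(f 0, …, f k) ⊗ h_b(f k, …, f m)) = h_{a+1+b}(f 0, …, f m)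
-- expresses the sequences (hₜ)ₜ of the children's gap weights through (hₜ(L))ₜ alone, by an operator
-- that is symmetric in α and β; iterating it l times gives both parts.

open import Defs
open import Level using (Level)
open import Function using (_∘_)
open import Data.Bool using (Bool; true; false; if_then_else_; _∧_; T)
import Data.Bool.Properties as BoolP
open import Data.Unit using (tt)
open import Data.Empty using (⊥-elim)
open import Data.Nat using (ℕ; zero; suc; _+_; _*_; _∸_; _<_; _≤_; _<ᵇ_; z≤n; s≤s)
import Data.Nat.Properties as ℕP
open import Data.Product using (_×_; _,_; proj₁; proj₂; uncurry; map₁)
open import Data.Sum using (_⊎_; inj₁; inj₂)
open import Data.List using (List; []; _∷_; _++_; map; concat; concatMap; applyUpTo; upTo; deduplicate)
import Data.List.Properties as ListP
open import Data.List.Relation.Unary.All as All using (All; []; _∷_)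
import Data.List.Relation.Unary.All.Properties as AllP
open import Data.List.Relation.Unary.Any using (here)
import Data.List.Relation.Unary.AllPairs as AllPairs
import Data.List.Relation.Unary.AllPairs.Properties as AllPairsP
open import Data.List.Relation.Unary.Unique.Propositional using (Unique)
import Data.List.Relation.Unary.Unique.Propositional.Properties as UniqueP
open import Data.List.Relation.Binary.Disjoint.Propositional using (Disjoint)
import Data.List.Membership.Propositional.Properties as ∈P
import Data.List.Relation.Binary.Pointwise as Pointwise
import Data.List.Relation.Binary.Permutation.Propositional as PermProp
import Data.List.Relation.Binary.Permutation.Propositional.Properties as PermPropP
import Data.List.Relation.Binary.Permutation.Setoid as PermS
import Data.List.Relation.Binary.Permutation.Setoid.Properties as PermSP
import Data.List.Relation.Binary.Permutation.Homogeneous as Perm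
import Relation.Binary.PropositionalEquality as ≡
open ≡ using (_≡_; _≢_)
open import Relation.Binary.Definitions using (DecidableEquality; tri<; tri≈; tri>)
open import Relation.Nullary using (¬?)
open import Algebra.Bundles using (AbelianGroup)
import Algebra.Definitions.RawMonoid as RawMonoidDefs
import Algebra.Properties.Monoid.Mult as MultP
import Algebra.Properties.CommutativeSemigroup as CommSemigroupP

concatMap-concatMap : ∀ {a b c} {A : Set a} {B : Set b} {C : Set c} (f : B → List C) (g : A → List B) xs →
  concatMap f (concatMap g xs) ≡ concatMap (λ x → concatMap f (g x)) xs
concatMap-concatMap f g []       = ≡.refl
concatMap-concatMap f g (x ∷ xs) =
  ≡.trans (ListP.concatMap-++ f (g x) (concatMap g xs)) (≡.cong (concatMap f (g x) ++_) (concatMap-concatMap f g xs))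

applyUpTo-++ : ∀ {a} {A : Set a} (g : ℕ → A) m n → applyUpTo g (m + n) ≡ applyUpTo g m ++ applyUpTo (λ j → g (m + j)) n
applyUpTo-++ g zero    n = ≡.refl
applyUpTo-++ g (suc m) n = ≡.cong (g 0 ∷_) (applyUpTo-++ (g ∘ suc) m n)

deduplicate-Unique : ∀ {A : Set} (_≟_ : DecidableEquality A) {xs} → Unique xs → deduplicate _≟_ xs ≡ xs
deduplicate-Unique _≟_ {[]}     AllPairs.[]        = ≡.refl
deduplicate-Unique _≟_ {x ∷ xs} (x∉ AllPairs.∷ xs!) rewrite deduplicate-Unique _≟_ xs! =
  ≡.cong (x ∷_) (ListP.filter-all (λ y → ¬? (x ≟ y)) x∉)

module Matchings where

  open ≡ using (refl; sym; trans; cong; cong₂; subst; module ≡-Reasoning)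

  <⇒<ᵇ≡true : ∀ {m n} → m < n → (m <ᵇ n) ≡ true
  <⇒<ᵇ≡true {zero}  (s≤s _)             = refl
  <⇒<ᵇ≡true {suc m} (s≤s m<n@(s≤s _)) = <⇒<ᵇ≡true m<n

  ≤⇒<ᵇ≡false : ∀ {m n} → n ≤ m → (m <ᵇ n) ≡ false
  ≤⇒<ᵇ≡false z≤n       = refl
  ≤⇒<ᵇ≡false (s≤s n≤m) = ≤⇒<ᵇ≡false n≤m

  -- The child with new edge {1, k + 2}

  relabelAt : ℕ → ℕ → ℕ
  relabelAt k = relabel (2 + k)

  relabelEdge : ℕ → Edge → Edge
  relabelEdge k e = relabelAt k (proj₁ e) , relabelAt k (proj₂ e)

  childAt : ℕ → Matching → Matching
  childAt k = child (2 + k)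

  relabelAt-cases : ∀ k v → v ≤ k × relabelAt k v ≡ suc v ⊎ k < v × relabelAt k v ≡ suc (suc v)
  relabelAt-cases k v with ℕP.≤-<-connex v k
  ... | inj₁ v≤k rewrite <⇒<ᵇ≡true (s≤s v≤k) = inj₁ (v≤k , refl)
  ... | inj₂ k<v rewrite ≤⇒<ᵇ≡false k<v       = inj₂ (k<v , refl)

  relabelAt-<ᵇ-relabelAt : ∀ k u v → (relabelAt k u <ᵇ relabelAt k v) ≡ (u <ᵇ v)
  relabelAt-<ᵇ-relabelAt k u v with relabelAt-cases k u | relabelAt-cases k v
  ... | inj₁ (_ , eu) | inj₁ (_ , ev) rewrite eu | ev = refl
  ... | inj₂ (_ , eu) | inj₂ (_ , ev) rewrite eu | ev = refl
  ... | inj₁ (u≤k , eu) | inj₂ (k<v , ev) rewrite eu | ev =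
    trans (<⇒<ᵇ≡true (ℕP.m<n⇒m<1+n u<v)) (sym (<⇒<ᵇ≡true u<v))
    where u<v = ℕP.≤-<-trans u≤k k<v
  ... | inj₂ (k<u , eu) | inj₁ (v≤k , ev) rewrite eu | ev =
    trans (≤⇒<ᵇ≡false (ℕP.m≤n⇒m≤1+n v≤u)) (sym (≤⇒<ᵇ≡false v≤u))
    where v≤u = ℕP.<⇒≤ (ℕP.≤-<-trans v≤k k<u)

  relabelAt-<⇒≢ : ∀ k {u v} → u < v → relabelAt k u ≢ relabelAt k v
  relabelAt-<⇒≢ k {u} {v} u<v eq with () ← trans (sym (≤⇒<ᵇ≡false (ℕP.≤-refl {relabelAt k v})))
    (subst (λ x → (x <ᵇ relabelAt k v) ≡ true) eq (trans (relabelAt-<ᵇ-relabelAt k u v) (<⇒<ᵇ≡true u<v)))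

  relabelAt-injective : ∀ k {u v} → relabelAt k u ≡ relabelAt k v → u ≡ v
  relabelAt-injective k {u} {v} eq with ℕP.<-cmp u v
  ... | tri< u<v _ _ = ⊥-elim (relabelAt-<⇒≢ k u<v eq)
  ... | tri≈ _ u≡v _ = u≡v
  ... | tri> _ _ v<u = ⊥-elim (relabelAt-<⇒≢ k v<u (sym eq))

  relabelAt-<ᵇ-below : ∀ {k w} v → w ≤ k → (relabelAt k v <ᵇ 2 + w) ≡ (v <ᵇ suc w)
  relabelAt-<ᵇ-below {k} v w≤k with relabelAt-cases k v
  ... | inj₁ (_ , e) rewrite e = refl
  ... | inj₂ (k<v , e) rewrite e =
    trans (≤⇒<ᵇ≡false (ℕP.<⇒≤ w<v)) (sym (≤⇒<ᵇ≡false w<v))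
    where w<v = ℕP.≤-<-trans w≤k k<v

  below-<ᵇ-relabelAt : ∀ {k w} v → w ≤ k → (suc w <ᵇ relabelAt k v) ≡ (w <ᵇ v)
  below-<ᵇ-relabelAt {k} v w≤k with relabelAt-cases k v
  ... | inj₁ (_ , e) rewrite e = refl
  ... | inj₂ (k<v , e) rewrite e =
    trans (<⇒<ᵇ≡true (ℕP.m<n⇒m<1+n w<v)) (sym (<⇒<ᵇ≡true w<v))
    where w<v = ℕP.≤-<-trans w≤k k<v

  relabelAt-<ᵇ-above : ∀ {k w} v → k ≤ w → (relabelAt k v <ᵇ 3 + w) ≡ (v <ᵇ suc w)
  relabelAt-<ᵇ-above {k} v k≤w with relabelAt-cases k v
  ... | inj₂ (_ , e) rewrite e = refl
  ... | inj₁ (v≤k , e) rewrite e =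
    trans (<⇒<ᵇ≡true (ℕP.m<n⇒m<1+n v<1+w)) (sym (<⇒<ᵇ≡true v<1+w))
    where v<1+w = s≤s (ℕP.≤-trans v≤k k≤w)

  above-<ᵇ-relabelAt : ∀ {k w} v → k ≤ w → (2 + w <ᵇ relabelAt k v) ≡ (w <ᵇ v)
  above-<ᵇ-relabelAt {k} v k≤w with relabelAt-cases k v
  ... | inj₂ (_ , e) rewrite e = refl
  ... | inj₁ (v≤k , e) rewrite e =
    trans (≤⇒<ᵇ≡false (ℕP.m≤n⇒m≤1+n v≤w)) (sym (≤⇒<ᵇ≡false v≤w))
    where v≤w = ℕP.≤-trans v≤k k≤w

  1≤relabelAt : ∀ k v → 1 ≤ relabelAt k v
  1≤relabelAt k v with relabelAt-cases k v
  ... | inj₁ (_ , e) rewrite e = s≤s z≤n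
  ... | inj₂ (_ , e) rewrite e = s≤s z≤n

  relabelAt-mono-< : ∀ k {u v} → u < v → relabelAt k u < relabelAt k v
  relabelAt-mono-< k {u} {v} u<v = ℕP.<ᵇ⇒< _ _ (subst T (sym (trans (relabelAt-<ᵇ-relabelAt k u v) (<⇒<ᵇ≡true u<v))) tt)

  count-map : ∀ {A B : Set} (p : B → Bool) (f : A → B) xs → count p (map f xs) ≡ count (λ x → p (f x)) xs
  count-map p f []       = refl
  count-map p f (x ∷ xs) = cong ((if p (f x) then 1 else 0) +_) (count-map p f xs)

  count-cong : ∀ {A : Set} {p q : A → Bool} {xs} → All (λ x → p x ≡ q x) xs → count p xs ≡ count q xs
  count-cong []                = refl
  count-cong {q = q} {x ∷ _} (px≡qx ∷ p≡q) rewrite px≡qx = cong ((if q x then 1 else 0) +_) (count-cong p≡q)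

  count-false : ∀ {A : Set} {p : A → Bool} {xs} → All (λ x → p x ≡ false) xs → count p xs ≡ 0
  count-false []             = refl
  count-false (px≡f ∷ p≡f) rewrite px≡f = count-false p≡f

  pairCount-map : ∀ R (g : Edge → Edge) → (∀ e f → R (g e) (g f) ≡ R e f) → ∀ M → pairCount R (map g M) ≡ pairCount R M
  pairCount-map R g R∘g≡R []      = refl
  pairCount-map R g R∘g≡R (e ∷ M) = cong₂ _+_
    (trans (count-map (R (g e)) g M) (count-cong (All.universal (R∘g≡R e) M)))
    (pairCount-map R g R∘g≡R M)

  ValidEdge : Edge → Set
  ValidEdge (a , b) = 1 ≤ a × a < b

  IsMatching⇒All-ValidEdge : ∀ {n M} → IsMatching n M → All ValidEdge M
  IsMatching⇒All-ValidEdge {n} {M} (a<b , _ , vs↭[2n]) =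
    go M a<b (PermPropP.All-resp-↭ (PermProp.↭-sym vs↭[2n]) (AllP.map⁺ (All.universal (λ _ → s≤s z≤n) (upTo (2 * n)))))
    where
    go : ∀ M → All (λ e → proj₁ e < proj₂ e) M → All (1 ≤_) (vertices M) → All ValidEdge M
    go []      []          _              = []
    go (e ∷ M) (a<b ∷ a<bs) (1≤a ∷ _ ∷ 1≤vs) = (1≤a , a<b) ∷ go M a<bs 1≤vs

  All-ValidEdge-childAt : ∀ k {M} → All ValidEdge M → All ValidEdge (childAt k M)
  All-ValidEdge-childAt k valid = (ℕP.≤-refl , s≤s (s≤s z≤n)) ∷ AllP.map⁺ (All.map relabelEdge-valid valid)
    where
    relabelEdge-valid : ∀ {e} → ValidEdge e → ValidEdge (relabelEdge k e)
    relabelEdge-valid (_ , a<b) = 1≤relabelAt k _ , relabelAt-mono-< k a<b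

  -- gap k lies between the points k and k + 1
  spanning : ℕ → Matching → ℕ
  spanning k = count (λ e → (proj₁ e <ᵇ suc k) ∧ (k <ᵇ proj₂ e))

  closedBy : ℕ → Matching → ℕ
  closedBy k = count (λ e → proj₂ e <ᵇ suc k)

  crossesᵇ-new : ∀ k {e} → ValidEdge e →
    crossesᵇ (1 , 2 + k) (relabelEdge k e) ≡ (proj₁ e <ᵇ suc k) ∧ (k <ᵇ proj₂ e)
  crossesᵇ-new k {a , b} (1≤a , _)
    rewrite trans (below-<ᵇ-relabelAt {k} a z≤n) (<⇒<ᵇ≡true 1≤a)
          | ≤⇒<ᵇ≡false (1≤relabelAt k a)
          | relabelAt-<ᵇ-below a (ℕP.≤-refl {k})
          | above-<ᵇ-relabelAt b (ℕP.≤-refl {k}) = BoolP.∨-identityʳ _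

  nestedᵇ-new : ∀ k {e} → ValidEdge e → nestedᵇ (1 , 2 + k) (relabelEdge k e) ≡ (proj₂ e <ᵇ suc k)
  nestedᵇ-new k {a , b} (1≤a , a<b)
    rewrite trans (below-<ᵇ-relabelAt {k} a z≤n) (<⇒<ᵇ≡true 1≤a)
          | ≤⇒<ᵇ≡false (1≤relabelAt k a)
          | trans (relabelAt-<ᵇ-relabelAt k a b) (<⇒<ᵇ≡true a<b)
          | relabelAt-<ᵇ-below b (ℕP.≤-refl {k}) = BoolP.∨-identityʳ _

  crossesᵇ-relabelEdge : ∀ k e f → crossesᵇ (relabelEdge k e) (relabelEdge k f) ≡ crossesᵇ e f
  crossesᵇ-relabelEdge k (a , b) (c , d)
    rewrite relabelAt-<ᵇ-relabelAt k a c | relabelAt-<ᵇ-relabelAt k c b | relabelAt-<ᵇ-relabelAt k b d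
          | relabelAt-<ᵇ-relabelAt k c a | relabelAt-<ᵇ-relabelAt k a d | relabelAt-<ᵇ-relabelAt k d b = refl

  nestedᵇ-relabelEdge : ∀ k e f → nestedᵇ (relabelEdge k e) (relabelEdge k f) ≡ nestedᵇ e f
  nestedᵇ-relabelEdge k (a , b) (c , d)
    rewrite relabelAt-<ᵇ-relabelAt k a c | relabelAt-<ᵇ-relabelAt k c d | relabelAt-<ᵇ-relabelAt k d b
          | relabelAt-<ᵇ-relabelAt k c a | relabelAt-<ᵇ-relabelAt k a b | relabelAt-<ᵇ-relabelAt k b d = refl

  cr-childAt : ∀ k {M} → All ValidEdge M → cr (childAt k M) ≡ spanning k M + cr M
  cr-childAt k {M} valid = cong₂ _+_
    (trans (count-map _ (relabelEdge k) M) (count-cong (All.map (crossesᵇ-new k) valid)))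
    (pairCount-map crossesᵇ (relabelEdge k) (crossesᵇ-relabelEdge k) M)

  ne-childAt : ∀ k {M} → All ValidEdge M → ne (childAt k M) ≡ closedBy k M + ne M
  ne-childAt k {M} valid = cong₂ _+_
    (trans (count-map _ (relabelEdge k) M) (count-cong (All.map (nestedᵇ-new k) valid)))
    (pairCount-map nestedᵇ (relabelEdge k) (nestedᵇ-relabelEdge k) M)

  spanning-childAt-0 : ∀ k M → spanning 0 (childAt k M) ≡ 0
  spanning-childAt-0 k M = trans (count-map _ (relabelEdge k) M)
    (count-false (All.universal (λ e → cong (_∧ (0 <ᵇ relabelAt k (proj₂ e)))
                                           (≤⇒<ᵇ≡false (1≤relabelAt k (proj₁ e)))) M))

  closedBy-childAt-0 : ∀ k M → closedBy 0 (childAt k M) ≡ 0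
  closedBy-childAt-0 k M = trans (count-map _ (relabelEdge k) M)
    (count-false (All.universal (λ e → ≤⇒<ᵇ≡false (1≤relabelAt k (proj₂ e))) M))

  spanning-childAt-below : ∀ {k w} M → w ≤ k → spanning (suc w) (childAt k M) ≡ suc (spanning w M)
  spanning-childAt-below {k} M w≤k rewrite <⇒<ᵇ≡true (s≤s w≤k) = cong suc (trans (count-map _ (relabelEdge k) M)
    (count-cong (All.universal (λ e → cong₂ _∧_ (relabelAt-<ᵇ-below (proj₁ e) w≤k)
                                                 (below-<ᵇ-relabelAt (proj₂ e) w≤k)) M)))

  closedBy-childAt-below : ∀ {k w} M → w ≤ k → closedBy (suc w) (childAt k M) ≡ closedBy w M
  closedBy-childAt-below {k} M w≤k rewrite ≤⇒<ᵇ≡false w≤k = trans (count-map _ (relabelEdge k) M)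
    (count-cong (All.universal (λ e → relabelAt-<ᵇ-below (proj₂ e) w≤k) M))

  spanning-childAt-above : ∀ {k w} M → k ≤ w → spanning (2 + w) (childAt k M) ≡ spanning w M
  spanning-childAt-above {k} M k≤w rewrite ≤⇒<ᵇ≡false k≤w = trans (count-map _ (relabelEdge k) M)
    (count-cong (All.universal (λ e → cong₂ _∧_ (relabelAt-<ᵇ-above (proj₁ e) k≤w)
                                                 (above-<ᵇ-relabelAt (proj₂ e) k≤w)) M))

  closedBy-childAt-above : ∀ {k w} M → k ≤ w → closedBy (2 + w) (childAt k M) ≡ suc (closedBy w M)
  closedBy-childAt-above {k} M k≤w rewrite <⇒<ᵇ≡true (s≤s k≤w) = cong suc (trans (count-map _ (relabelEdge k) M)
    (count-cong (All.universal (λ e → relabelAt-<ᵇ-above (proj₂ e) k≤w) M)))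

  -- The sets 𝓣(M,l) without deduplication

  children≡applyUpTo : ∀ n M → children n M ≡ applyUpTo (λ k → childAt k M) (suc (2 * n))
  children≡applyUpTo n M = begin
    map (λ x → child x M) (map (2 +_) (upTo (2 * n + 1)))  ≡⟨ cong (map (λ x → child x M)) (ListP.map-upTo (2 +_) (2 * n + 1)) ⟩
    map (λ x → child x M) (applyUpTo (2 +_) (2 * n + 1))   ≡⟨ ListP.map-applyUpTo (2 +_) (λ x → child x M) (2 * n + 1) ⟩
    applyUpTo (λ k → childAt k M) (2 * n + 1)               ≡⟨ cong (applyUpTo (λ k → childAt k M)) (ℕP.+-comm (2 * n) 1) ⟩
    applyUpTo (λ k → childAt k M) (suc (2 * n))             ∎
    where open ≡-Reasoning

  relabelEdge-injective : ∀ k {e f} → relabelEdge k e ≡ relabelEdge k f → e ≡ f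
  relabelEdge-injective k eq = cong₂ _,_ (relabelAt-injective k (cong proj₁ eq)) (relabelAt-injective k (cong proj₂ eq))

  childAt-injective : ∀ {i j M N} → childAt i M ≡ childAt j N → i ≡ j × M ≡ N
  childAt-injective {i} eq with ListP.∷-injective eq
  ... | refl , tails≡ = refl , ListP.map-injective (relabelEdge-injective i) tails≡

  children-Unique : ∀ n M → Unique (children n M)
  children-Unique n M rewrite children≡applyUpTo n M =
    UniqueP.applyUpTo⁺₁ (λ k → childAt k M) (suc (2 * n)) (λ i<j _ eq → ℕP.<⇒≢ i<j (proj₁ (childAt-injective eq)))

  children-Disjoint : ∀ n {M N} → M ≢ N → Disjoint (children n M) (children n N)
  children-Disjoint n {M} {N} M≢N rewrite children≡applyUpTo n M | children≡applyUpTo n N = disjoint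
    where
    disjoint : Disjoint (applyUpTo (λ k → childAt k M) _) (applyUpTo (λ k → childAt k N) _)
    disjoint (C∈ , C∈′) with ∈P.∈-applyUpTo⁻ (λ k → childAt k M) C∈ | ∈P.∈-applyUpTo⁻ (λ k → childAt k N) C∈′
    ... | _ , _ , refl | _ , _ , eq = M≢N (proj₂ (childAt-injective eq))

  concatMap-children-Unique : ∀ n {L} → Unique L → Unique (concatMap (children n) L)
  concatMap-children-Unique n {L} L! = UniqueP.concat⁺
    (AllP.map⁺ (All.universal (children-Unique n) L))
    (AllPairsP.map⁺ (AllPairs.map (children-Disjoint n) L!))

  tree : ℕ → Matching → ℕ → List Matching
  tree n M zero    = M ∷ []
  tree n M (suc l) = concatMap (children (n + l)) (tree n M l)

  tree-Unique : ∀ n M l → Unique (tree n M l)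
  tree-Unique n M zero    = [] AllPairs.∷ AllPairs.[]
  tree-Unique n M (suc l) = concatMap-children-Unique (n + l) (tree-Unique n M l)

  𝓣≡tree : ∀ n M l → 𝓣 n M l ≡ tree n M l
  𝓣≡tree n M zero    = refl
  𝓣≡tree n M (suc l) rewrite 𝓣≡tree n M l = deduplicate-Unique _≟M_ (tree-Unique n M (suc l))

  tree-suc : ∀ n M l → tree n M (suc l) ≡ concatMap (λ C → tree (suc n) C l) (children n M)
  tree-suc n M zero = begin
    concatMap (children (n + 0)) (M ∷ [])  ≡⟨ ListP.++-identityʳ _ ⟩
    children (n + 0) M                     ≡⟨ cong (λ m → children m M) (ℕP.+-identityʳ n) ⟩
    children n M                           ≡⟨ ListP.concatMap-pure (children n M) ⟨
    concatMap (λ C → C ∷ []) (children n M) ∎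
    where open ≡-Reasoning
  tree-suc n M (suc l) = begin
    concatMap (children (n + suc l)) (tree n M (suc l))
      ≡⟨ cong (concatMap (children (n + suc l))) (tree-suc n M l) ⟩
    concatMap (children (n + suc l)) (concatMap (λ C → tree (suc n) C l) (children n M))
      ≡⟨ concatMap-concatMap (children (n + suc l)) (λ C → tree (suc n) C l) (children n M) ⟩
    concatMap (λ C → concatMap (children (n + suc l)) (tree (suc n) C l)) (children n M)
      ≡⟨ ListP.concatMap-cong (λ C → cong (λ m → concatMap (children m) (tree (suc n) C l)) (ℕP.+-suc n l)) (children n M) ⟩
    concatMap (λ C → tree (suc n) C (suc l)) (children n M) ∎
    where open ≡-Reasoning

open Matchings

module Multisets {c ℓ : Level} (G : AbelianGroup c ℓ) where

  open AbelianGroup G renaming (Carrier to A)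
  open RawMonoidDefs rawMonoid using () renaming (_×_ to _·_)
  open MultP monoid using (×-homo-+)
  open PermS setoid using (_↭_; ↭-refl; ↭-sym; ↭-trans; ↭-reflexive; module PermutationReasoning)
  open PermSP setoid using (++⁺; ++⁺ˡ; ++⁺ʳ; ++-comm; shifts; map⁺)
  open PermutationReasoning

  ++-assoc-↭ : ∀ (xs ys zs : List A) → (xs ++ ys) ++ zs ↭ xs ++ (ys ++ zs)
  ++-assoc-↭ xs ys zs = ↭-reflexive (ListP.++-assoc xs ys zs)

  map-≈ : ∀ {b} {B : Set b} (f g : B → A) (xs : List B) → (∀ x → f x ≈ g x) → map f xs ↭ map g xs
  map-≈ f g xs f≈g = Perm.refl (Pointwise.map⁺ f g (Pointwise.refl (λ {x} → f≈g x)))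

  shift : A → List A → List A
  shift c = map (c ∙_)

  shift-cong : ∀ c {xs ys} → xs ↭ ys → shift c xs ↭ shift c ys
  shift-cong c = map⁺ setoid ∙-congˡ

  shift-≈ : ∀ {c d} xs → c ≈ d → shift c xs ↭ shift d xs
  shift-≈ {c} {d} xs c≈d = map-≈ (c ∙_) (d ∙_) xs (λ x → ∙-congʳ c≈d)

  shift-shift : ∀ c d xs → shift c (shift d xs) ↭ shift (c ∙ d) xs
  shift-shift c d xs = ↭-trans (↭-reflexive (≡.sym (ListP.map-∘ xs))) (map-≈ _ _ xs (λ x → sym (assoc c d x)))

  shift-comm : ∀ c d xs → shift c (shift d xs) ↭ shift d (shift c xs)
  shift-comm c d xs = begin
    shift c (shift d xs) ↭⟨ shift-shift c d xs ⟩
    shift (c ∙ d) xs     ↭⟨ shift-≈ xs (comm c d) ⟩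
    shift (d ∙ c) xs     ↭⟨ shift-shift d c xs ⟨
    shift d (shift c xs) ∎

  shift-ε : ∀ xs → shift ε xs ↭ xs
  shift-ε xs = ↭-trans (map-≈ (ε ∙_) (λ x → x) xs identityˡ) (↭-reflexive (ListP.map-id xs))

  shift-++ : ∀ c xs ys → shift c (xs ++ ys) ≡ shift c xs ++ shift c ys
  shift-++ c = ListP.map-++ (c ∙_)

  shift-concatMap : ∀ {b} {B : Set b} c (f : B → List A) xs → shift c (concatMap f xs) ≡ concatMap (λ x → shift c (f x)) xs
  shift-concatMap c = ListP.map-concatMap (c ∙_)

  shift-cancel : ∀ c {xs ys} → shift c xs ↭ shift c ys → xs ↭ ys
  shift-cancel c {xs} {ys} c+xs↭c+ys = begin
    xs                       ↭⟨ shift-ε xs ⟨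
    shift ε xs               ↭⟨ shift-≈ xs (inverseˡ c) ⟨
    shift (c ⁻¹ ∙ c) xs      ↭⟨ shift-shift (c ⁻¹) c xs ⟨
    shift (c ⁻¹) (shift c xs) ↭⟨ shift-cong (c ⁻¹) c+xs↭c+ys ⟩
    shift (c ⁻¹) (shift c ys) ↭⟨ shift-shift (c ⁻¹) c ys ⟩
    shift (c ⁻¹ ∙ c) ys      ↭⟨ shift-≈ ys (inverseˡ c) ⟩
    shift ε ys               ↭⟨ shift-ε ys ⟩
    ys                       ∎

  concatMap-cong-↭ : ∀ {b} {B : Set b} (f g : B → List A) xs → (∀ x → f x ↭ g x) → concatMap f xs ↭ concatMap g xs
  concatMap-cong-↭ f g []       f↭g = ↭-refl
  concatMap-cong-↭ f g (x ∷ xs) f↭g = ++⁺ (f↭g x) (concatMap-cong-↭ f g xs f↭g)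

  concatMap-resp-↭ : ∀ (f : A → List A) → (∀ {x y} → x ≈ y → f x ↭ f y) →
                     ∀ {xs ys} → xs ↭ ys → concatMap f xs ↭ concatMap f ys
  concatMap-resp-↭ f f-resp (Perm.refl xs≋ys) = go xs≋ys
    where
    go : ∀ {xs ys} → Pointwise.Pointwise _≈_ xs ys → concatMap f xs ↭ concatMap f ys
    go Pointwise.[]           = ↭-refl
    go (x≈y Pointwise.∷ xs≋ys) = ++⁺ (f-resp x≈y) (go xs≋ys)
  concatMap-resp-↭ f f-resp (Perm.prep x≈y p) = ++⁺ (f-resp x≈y) (concatMap-resp-↭ f f-resp p)
  concatMap-resp-↭ f f-resp {x ∷ y ∷ xs} {y′ ∷ x′ ∷ ys} (Perm.swap x≈x′ y≈y′ p) = begin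
    f x ++ (f y ++ concatMap f xs)   ↭⟨ shifts (f x) (f y) ⟩
    f y ++ (f x ++ concatMap f xs)   ↭⟨ ++⁺ (f-resp y≈y′) (++⁺ (f-resp x≈x′) (concatMap-resp-↭ f f-resp p)) ⟩
    f y′ ++ (f x′ ++ concatMap f ys) ∎
  concatMap-resp-↭ f f-resp (Perm.trans p q) = ↭-trans (concatMap-resp-↭ f f-resp p) (concatMap-resp-↭ f f-resp q)

  concatMap-distrib-++ : ∀ {b} {B : Set b} (f g : B → List A) xs →
    concatMap (λ x → f x ++ g x) xs ↭ concatMap f xs ++ concatMap g xs
  concatMap-distrib-++ f g []       = ↭-refl
  concatMap-distrib-++ f g (x ∷ xs) = begin
    (f x ++ g x) ++ concatMap (λ x → f x ++ g x) xs    ↭⟨ ++⁺ˡ (f x ++ g x) (concatMap-distrib-++ f g xs) ⟩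
    (f x ++ g x) ++ (concatMap f xs ++ concatMap g xs) ↭⟨ ++-assoc-↭ (f x) (g x) _ ⟩
    f x ++ (g x ++ (concatMap f xs ++ concatMap g xs)) ↭⟨ ++⁺ˡ (f x) (shifts (g x) (concatMap f xs)) ⟩
    f x ++ (concatMap f xs ++ (g x ++ concatMap g xs)) ↭⟨ ++-assoc-↭ (f x) _ _ ⟨
    (f x ++ concatMap f xs) ++ (g x ++ concatMap g xs) ∎

  concatMap-[] : ∀ {b} {B : Set b} (xs : List B) → concatMap (λ _ → [] {A = A}) xs ≡ []
  concatMap-[] []       = ≡.refl
  concatMap-[] (x ∷ xs) = concatMap-[] xs

  concatMap-comm : ∀ {b b′} {B : Set b} {C : Set b′} (h : B → C → List A) xs ys →
    concatMap (λ x → concatMap (h x) ys) xs ↭ concatMap (λ y → concatMap (λ x → h x y) xs) ys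
  concatMap-comm h []       ys = ↭-reflexive (≡.sym (concatMap-[] ys))
  concatMap-comm h (x ∷ xs) ys = ↭-trans (++⁺ˡ (concatMap (h x) ys) (concatMap-comm h xs ys))
    (↭-sym (concatMap-distrib-++ (h x) (λ y → concatMap (λ x → h x y) xs) ys))

  ⋃ : ℕ → (ℕ → List A) → List A
  ⋃ n F = concat (applyUpTo F n)

  ⋃≡concatMap : ∀ n F → ⋃ n F ≡ concatMap F (upTo n)
  ⋃≡concatMap n F = ≡.cong concat (≡.sym (ListP.map-upTo F n))

  ⋃-cong : ∀ n (F F′ : ℕ → List A) → (∀ k → k < n → F k ↭ F′ k) → ⋃ n F ↭ ⋃ n F′
  ⋃-cong zero    F F′ F↭F′ = ↭-refl
  ⋃-cong (suc n) F F′ F↭F′ =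
    ++⁺ (F↭F′ 0 (s≤s z≤n)) (⋃-cong n (F ∘ suc) (F′ ∘ suc) (λ k k<n → F↭F′ (suc k) (s≤s k<n)))

  shift-⋃ : ∀ c n F → shift c (⋃ n F) ≡ ⋃ n (λ k → shift c (F k))
  shift-⋃ c zero    F = ≡.refl
  shift-⋃ c (suc n) F = ≡.trans (shift-++ c (F 0) _) (≡.cong (shift c (F 0) ++_) (shift-⋃ c n (λ k → F (suc k))))

  antidiagonal : ℕ → List (ℕ × ℕ)
  antidiagonal zero    = (0 , 0) ∷ []
  antidiagonal (suc t) = (0 , suc t) ∷ map (map₁ suc) (antidiagonal t)

  ⋃₂ : ℕ → (ℕ → ℕ → List A) → List A
  ⋃₂ t F = concatMap (uncurry F) (antidiagonal t)

  ⋃₂-suc : ∀ t F → ⋃₂ (suc t) F ≡ F 0 (suc t) ++ ⋃₂ t (λ i j → F (suc i) j)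
  ⋃₂-suc t F = ≡.cong (F 0 (suc t) ++_) (ListP.concatMap-map _ _ (antidiagonal t))

  ⋃₂-cong : ∀ t {F F′ : ℕ → ℕ → List A} → (∀ i j → F i j ↭ F′ i j) → ⋃₂ t F ↭ ⋃₂ t F′
  ⋃₂-cong t F↭F′ = concatMap-cong-↭ _ _ (antidiagonal t) (λ (i , j) → F↭F′ i j)

  ⋃₂-distrib-++ : ∀ t F F′ → ⋃₂ t (λ i j → F i j ++ F′ i j) ↭ ⋃₂ t F ++ ⋃₂ t F′
  ⋃₂-distrib-++ t F F′ = concatMap-distrib-++ _ _ (antidiagonal t)

  ⋃₂-[] : ∀ t → ⋃₂ t (λ _ _ → []) ≡ []
  ⋃₂-[] t = concatMap-[] (antidiagonal t)

  shift-⋃₂ : ∀ c t F → shift c (⋃₂ t F) ≡ ⋃₂ t (λ i j → shift c (F i j))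
  shift-⋃₂ c t F = shift-concatMap c _ (antidiagonal t)

  ⋃-⋃₂ : ∀ n t (F : ℕ → ℕ → ℕ → List A) →
         ⋃ n (λ k → ⋃₂ t (F k)) ↭ ⋃₂ t (λ i j → ⋃ n (λ k → F k i j))
  ⋃-⋃₂ n t F = begin
    ⋃ n (λ k → ⋃₂ t (F k))
      ≡⟨ ⋃≡concatMap n _ ⟩
    concatMap (λ k → concatMap (uncurry (F k)) (antidiagonal t)) (upTo n)
      ↭⟨ concatMap-comm (λ k → uncurry (F k)) (upTo n) (antidiagonal t) ⟩
    concatMap (λ (i , j) → concatMap (λ k → F k i j) (upTo n)) (antidiagonal t)
      ≡⟨ ≡.sym (ListP.concatMap-cong (λ (i , j) → ⋃≡concatMap n (λ k → F k i j)) (antidiagonal t)) ⟩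
    ⋃₂ t (λ i j → ⋃ n (λ k → F k i j)) ∎

  ⋃₂-split : ∀ a b F → ⋃₂ (a + suc b) F ↭ ⋃₂ a (λ i j → F i (j + suc b)) ++ ⋃₂ b (λ i j → F (suc a + i) j)
  ⋃₂-split zero    b F = ↭-reflexive (≡.trans (⋃₂-suc b F)
    (≡.cong (_++ ⋃₂ b (λ i j → F (suc i) j)) (≡.sym (ListP.++-identityʳ (F 0 (suc b))))))
  ⋃₂-split (suc a) b F = begin
    ⋃₂ (suc (a + suc b)) F
      ≡⟨ ⋃₂-suc (a + suc b) F ⟩
    F 0 (suc (a + suc b)) ++ ⋃₂ (a + suc b) (λ i j → F (suc i) j)
      ↭⟨ ++⁺ˡ (F 0 (suc (a + suc b))) (⋃₂-split a b (λ i j → F (suc i) j)) ⟩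
    F 0 (suc (a + suc b)) ++ (⋃₂ a (λ i j → F (suc i) (j + suc b)) ++ ⋃₂ b (λ i j → F (suc (suc a + i)) j))
      ↭⟨ ++-assoc-↭ (F 0 (suc (a + suc b))) _ _ ⟨
    (F 0 (suc (a + suc b)) ++ ⋃₂ a (λ i j → F (suc i) (j + suc b))) ++ ⋃₂ b (λ i j → F (suc (suc a + i)) j)
      ≡⟨ ≡.cong (_++ ⋃₂ b (λ i j → F (suc (suc a + i)) j)) (⋃₂-suc a (λ i j → F i (j + suc b))) ⟨
    ⋃₂ (suc a) (λ i j → F i (j + suc b)) ++ ⋃₂ b (λ i j → F (suc (suc a) + i) j) ∎

  ⋃₂-sucʳ : ∀ t F → ⋃₂ (suc t) F ↭ ⋃₂ t (λ i j → F i (suc j)) ++ F (suc t) 0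
  ⋃₂-sucʳ zero    F = ↭-reflexive (≡.trans (≡.cong (F 0 1 ++_) (ListP.++-identityʳ (F 1 0)))
    (≡.cong (_++ F 1 0) (≡.sym (ListP.++-identityʳ (F 0 1)))))
  ⋃₂-sucʳ (suc t) F = begin
    ⋃₂ (suc (suc t)) F
      ≡⟨ ⋃₂-suc (suc t) F ⟩
    F 0 (suc (suc t)) ++ ⋃₂ (suc t) (λ i j → F (suc i) j)
      ↭⟨ ++⁺ˡ (F 0 (suc (suc t))) (⋃₂-sucʳ t (λ i j → F (suc i) j)) ⟩
    F 0 (suc (suc t)) ++ (⋃₂ t (λ i j → F (suc i) (suc j)) ++ F (suc (suc t)) 0)
      ↭⟨ ++-assoc-↭ (F 0 (suc (suc t))) _ _ ⟨
    (F 0 (suc (suc t)) ++ ⋃₂ t (λ i j → F (suc i) (suc j))) ++ F (suc (suc t)) 0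
      ≡⟨ ≡.cong (_++ F (suc (suc t)) 0) (⋃₂-suc t (λ i j → F i (suc j))) ⟨
    ⋃₂ (suc t) (λ i j → F i (suc j)) ++ F (suc (suc t)) 0 ∎

  ⋃₂-flip : ∀ t F → ⋃₂ t F ↭ ⋃₂ t (λ i j → F j i)
  ⋃₂-flip zero    F = ↭-refl
  ⋃₂-flip (suc t) F = begin
    ⋃₂ (suc t) F                                ↭⟨ ⋃₂-sucʳ t F ⟩
    ⋃₂ t (λ i j → F i (suc j)) ++ F (suc t) 0   ↭⟨ ++-comm _ (F (suc t) 0) ⟩
    F (suc t) 0 ++ ⋃₂ t (λ i j → F i (suc j))   ↭⟨ ++⁺ˡ (F (suc t) 0) (⋃₂-flip t (λ i j → F i (suc j))) ⟩
    F (suc t) 0 ++ ⋃₂ t (λ i j → F j (suc i))   ≡⟨ ⋃₂-suc t (λ i j → F j i) ⟨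
    ⋃₂ (suc t) (λ i j → F j i)                  ∎

  infixr 6 _⊗_
  _⊗_ : List A → List A → List A
  xs ⊗ ys = concatMap (λ x → shift x ys) xs

  ⊗-++ : ∀ xs ys zs → (xs ++ ys) ⊗ zs ≡ xs ⊗ zs ++ ys ⊗ zs
  ⊗-++ xs ys zs = ListP.concatMap-++ (λ x → shift x zs) xs ys

  ⊗-cong : ∀ {xs ys zs ws} → xs ↭ ys → zs ↭ ws → xs ⊗ zs ↭ ys ⊗ ws
  ⊗-cong {xs} {ys} {zs} xs↭ys zs↭ws = ↭-trans
    (concatMap-resp-↭ (λ x → shift x zs) (shift-≈ zs) xs↭ys)
    (concatMap-cong-↭ _ _ ys (λ y → shift-cong y zs↭ws))

  [x]⊗ : ∀ x ys → (x ∷ []) ⊗ ys ↭ shift x ys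
  [x]⊗ x ys = ↭-reflexive (ListP.++-identityʳ (shift x ys))

  shift-⊗ˡ : ∀ c xs ys → shift c xs ⊗ ys ↭ shift c (xs ⊗ ys)
  shift-⊗ˡ c xs ys = begin
    concatMap (λ x → shift x ys) (shift c xs)    ≡⟨ ListP.concatMap-map _ _ xs ⟩
    concatMap (λ x → shift (c ∙ x) ys) xs        ↭⟨ concatMap-cong-↭ _ _ xs (λ x → shift-shift c x ys) ⟨
    concatMap (λ x → shift c (shift x ys)) xs    ≡⟨ shift-concatMap c (λ x → shift x ys) xs ⟨
    shift c (xs ⊗ ys)                            ∎

  shift-⊗ʳ : ∀ c xs ys → xs ⊗ shift c ys ↭ shift c (xs ⊗ ys)
  shift-⊗ʳ c xs ys = begin
    concatMap (λ x → shift x (shift c ys)) xs    ↭⟨ concatMap-cong-↭ _ _ xs (λ x → shift-comm x c ys) ⟩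
    concatMap (λ x → shift c (shift x ys)) xs    ≡⟨ shift-concatMap c (λ x → shift x ys) xs ⟨
    shift c (xs ⊗ ys)                            ∎

  shift-⊗ : ∀ c d xs ys → shift c xs ⊗ shift d ys ↭ shift (c ∙ d) (xs ⊗ ys)
  shift-⊗ c d xs ys = begin
    shift c xs ⊗ shift d ys       ↭⟨ shift-⊗ˡ c xs (shift d ys) ⟩
    shift c (xs ⊗ shift d ys)     ↭⟨ shift-cong c (shift-⊗ʳ d xs ys) ⟩
    shift c (shift d (xs ⊗ ys))   ↭⟨ shift-shift c d _ ⟩
    shift (c ∙ d) (xs ⊗ ys)       ∎

  ⋃₂-⊗ : ∀ t F zs → ⋃₂ t F ⊗ zs ≡ ⋃₂ t (λ i j → F i j ⊗ zs)
  ⋃₂-⊗ t F zs = concatMap-concatMap (λ x → shift x zs) (uncurry F) (antidiagonal t)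

  -- Complete homogeneous sums hₜ

  complete : ℕ → List A → List A
  complete zero    L       = ε ∷ []
  complete (suc t) []      = []
  complete (suc t) (v ∷ L) = shift v (complete t (v ∷ L)) ++ complete (suc t) L

  complete-extract : ∀ X y Y t →
    complete (suc t) (X ++ y ∷ Y) ↭ shift y (complete t (X ++ y ∷ Y)) ++ complete (suc t) (X ++ Y)
  complete-extract []      y Y t    = ↭-refl
  complete-extract (x ∷ X) y Y zero = begin
    shift x (ε ∷ []) ++ complete 1 (X ++ y ∷ Y)                        ↭⟨ ++⁺ˡ _ (complete-extract X y Y 0) ⟩
    shift x (ε ∷ []) ++ (shift y (ε ∷ []) ++ complete 1 (X ++ Y))      ↭⟨ shifts (shift x (ε ∷ [])) (shift y (ε ∷ [])) ⟩
    shift y (ε ∷ []) ++ (shift x (ε ∷ []) ++ complete 1 (X ++ Y))      ∎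
  complete-extract (x ∷ X) y Y (suc t) = begin
    shift x (complete (suc t) (x ∷ Z)) ++ complete (suc (suc t)) Z
      ↭⟨ ++⁺ (shift-cong x (complete-extract (x ∷ X) y Y t)) (complete-extract X y Y (suc t)) ⟩
    shift x (shift y a ++ b) ++ (c′ ++ d)
      ≡⟨ ≡.cong (_++ (c′ ++ d)) (shift-++ x (shift y a) b) ⟩
    (shift x (shift y a) ++ shift x b) ++ (c′ ++ d)
      ↭⟨ ++-assoc-↭ (shift x (shift y a)) (shift x b) (c′ ++ d) ⟩
    shift x (shift y a) ++ (shift x b ++ (c′ ++ d))
      ↭⟨ ++⁺ (shift-comm x y a) (shifts (shift x b) c′) ⟩
    shift y (shift x a) ++ (c′ ++ (shift x b ++ d))
      ↭⟨ ++-assoc-↭ (shift y (shift x a)) c′ (shift x b ++ d) ⟨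
    (shift y (shift x a) ++ c′) ++ (shift x b ++ d)
      ≡⟨ ≡.cong (_++ (shift x b ++ d)) (shift-++ y (shift x a) (complete (suc t) Z)) ⟨
    shift y (complete (suc t) (x ∷ Z)) ++ complete (suc (suc t)) (x ∷ W) ∎
    where
    Z  = X ++ y ∷ Y
    W  = X ++ Y
    a  = complete t (x ∷ Z)
    b  = complete (suc t) (x ∷ W)
    c′ = shift y (complete (suc t) Z)
    d  = complete (suc (suc t)) W

  complete-swap : ∀ x y L t → complete t (x ∷ y ∷ L) ↭ complete t (y ∷ x ∷ L)
  complete-swap x y L zero    = ↭-refl
  complete-swap x y L (suc t) =
    ↭-trans (complete-extract (x ∷ []) y L t) (++⁺ʳ _ (shift-cong y (complete-swap x y L t)))

  complete-∷-cong : ∀ {x y L L′} → x ≈ y → (∀ t → complete t L ↭ complete t L′) →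
                    ∀ t → complete t (x ∷ L) ↭ complete t (y ∷ L′)
  complete-∷-cong x≈y L↭L′ zero    = ↭-refl
  complete-∷-cong x≈y L↭L′ (suc t) =
    ++⁺ (↭-trans (shift-cong _ (complete-∷-cong x≈y L↭L′ t)) (shift-≈ _ x≈y)) (L↭L′ (suc t))

  complete-resp-↭ : ∀ {L L′} → L ↭ L′ → ∀ t → complete t L ↭ complete t L′
  complete-resp-↭ (Perm.refl L≋L′)         = pointwise L≋L′
    where
    pointwise : ∀ {L L′} → Pointwise.Pointwise _≈_ L L′ → ∀ t → complete t L ↭ complete t L′
    pointwise Pointwise.[]          t = ↭-refl
    pointwise (x≈y Pointwise.∷ L≋L′) t = complete-∷-cong x≈y (pointwise L≋L′) t
  complete-resp-↭ (Perm.prep x≈y L↭L′)     = complete-∷-cong x≈y (complete-resp-↭ L↭L′)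
  complete-resp-↭ {x ∷ y ∷ L} (Perm.swap x≈x′ y≈y′ L↭L′) t =
    ↭-trans (complete-swap x y L t) (complete-∷-cong y≈y′ (complete-∷-cong x≈x′ (complete-resp-↭ L↭L′)) t)
  complete-resp-↭ (Perm.trans L↭L′ L′↭L″) t = ↭-trans (complete-resp-↭ L↭L′ t) (complete-resp-↭ L′↭L″ t)

  complete-1 : ∀ L → complete 1 L ↭ L
  complete-1 []      = ↭-refl
  complete-1 (v ∷ L) = Perm.prep (identityʳ v) (complete-1 L)

  complete-[x] : ∀ v t → complete t (v ∷ []) ↭ (t · v) ∷ []
  complete-[x] v zero    = ↭-refl
  complete-[x] v (suc t) = ↭-trans (↭-reflexive (ListP.++-identityʳ _)) (shift-cong v (complete-[x] v t))

  complete-∷ : ∀ v L t → complete t (v ∷ L) ↭ ⋃₂ t (λ i j → shift (i · v) (complete j L))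
  complete-∷ v L zero    = Perm.refl (sym (identityˡ ε) Pointwise.∷ Pointwise.[])
  complete-∷ v L (suc t) = begin
    shift v (complete t (v ∷ L)) ++ complete (suc t) L
      ↭⟨ ++⁺ʳ _ (shift-cong v (complete-∷ v L t)) ⟩
    shift v (⋃₂ t (λ i j → shift (i · v) (complete j L))) ++ complete (suc t) L
      ≡⟨ ≡.cong (_++ complete (suc t) L) (shift-⋃₂ v t _) ⟩
    ⋃₂ t (λ i j → shift v (shift (i · v) (complete j L))) ++ complete (suc t) L
      ↭⟨ ++⁺ʳ _ (⋃₂-cong t (λ i j → shift-shift v (i · v) (complete j L))) ⟩
    ⋃₂ t (λ i j → shift (suc i · v) (complete j L)) ++ complete (suc t) L
      ↭⟨ ++-comm _ (complete (suc t) L) ⟩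
    complete (suc t) L ++ ⋃₂ t (λ i j → shift (suc i · v) (complete j L))
      ↭⟨ ++⁺ʳ _ (shift-ε (complete (suc t) L)) ⟨
    shift (0 · v) (complete (suc t) L) ++ ⋃₂ t (λ i j → shift (suc i · v) (complete j L))
      ≡⟨ ⋃₂-suc t (λ i j → shift (i · v) (complete j L)) ⟨
    ⋃₂ (suc t) (λ i j → shift (i · v) (complete j L)) ∎

  complete-shift : ∀ c t L → complete t (shift c L) ↭ shift (t · c) (complete t L)
  complete-shift c zero    L       = Perm.refl (sym (identityˡ ε) Pointwise.∷ Pointwise.[])
  complete-shift c (suc t) []      = ↭-refl
  complete-shift c (suc t) (v ∷ L) = begin
    shift (c ∙ v) (complete t (shift c (v ∷ L))) ++ complete (suc t) (shift c L)
      ↭⟨ ++⁺ (shift-cong (c ∙ v) (complete-shift c t (v ∷ L))) (complete-shift c (suc t) L) ⟩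
    shift (c ∙ v) (shift (t · c) (complete t (v ∷ L))) ++ shift (suc t · c) (complete (suc t) L)
      ↭⟨ ++⁺ʳ _ (shift-comm′ (complete t (v ∷ L))) ⟩
    shift (suc t · c) (shift v (complete t (v ∷ L))) ++ shift (suc t · c) (complete (suc t) L)
      ≡⟨ shift-++ (suc t · c) (shift v (complete t (v ∷ L))) (complete (suc t) L) ⟨
    shift (suc t · c) (complete (suc t) (v ∷ L)) ∎
    where
    regroup : (c ∙ v) ∙ (t · c) ≈ (c ∙ (t · c)) ∙ v
    regroup = trans (assoc c v (t · c)) (trans (∙-congˡ (comm v (t · c))) (sym (assoc c (t · c) v)))
    shift-comm′ : ∀ xs → shift (c ∙ v) (shift (t · c) xs) ↭ shift (suc t · c) (shift v xs)
    shift-comm′ xs = begin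
      shift (c ∙ v) (shift (t · c) xs)  ↭⟨ shift-shift (c ∙ v) (t · c) xs ⟩
      shift ((c ∙ v) ∙ (t · c)) xs      ↭⟨ shift-≈ xs regroup ⟩
      shift (suc t · c ∙ v) xs          ↭⟨ shift-shift (suc t · c) v xs ⟨
      shift (suc t · c) (shift v xs)    ∎

  complete-++ : ∀ X Y t → complete t (X ++ Y) ↭ ⋃₂ t (λ i j → complete i X ⊗ complete j Y)
  complete-++ [] Y zero = ↭-trans (↭-sym (shift-ε (complete 0 Y)))
    (↭-reflexive (≡.sym (≡.trans (ListP.++-identityʳ _) (ListP.++-identityʳ _))))
  complete-++ [] Y (suc t) = begin
    complete (suc t) Y                                     ↭⟨ shift-ε _ ⟨
    shift ε (complete (suc t) Y)                           ≡⟨ ListP.++-identityʳ _ ⟨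
    (ε ∷ []) ⊗ complete (suc t) Y                          ≡⟨ ListP.++-identityʳ _ ⟨
    ((ε ∷ []) ⊗ complete (suc t) Y) ++ []                  ≡⟨ ≡.cong (((ε ∷ []) ⊗ complete (suc t) Y) ++_) (⋃₂-[] t) ⟨
    ((ε ∷ []) ⊗ complete (suc t) Y) ++ ⋃₂ t (λ _ _ → [])   ≡⟨ ⋃₂-suc t (λ i j → complete i [] ⊗ complete j Y) ⟨
    ⋃₂ (suc t) (λ i j → complete i [] ⊗ complete j Y)      ∎
  complete-++ (x ∷ X) Y zero    = Perm.refl (sym (identityˡ ε) Pointwise.∷ Pointwise.[])
  complete-++ (x ∷ X) Y (suc t) = begin
    shift x (complete t (x ∷ X ++ Y)) ++ complete (suc t) (X ++ Y)
      ↭⟨ ++⁺ (shift-cong x (complete-++ (x ∷ X) Y t)) (complete-++ X Y (suc t)) ⟩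
    shift x (⋃₂ t (λ i j → Hx i ⊗ HY j)) ++ ⋃₂ (suc t) (λ i j → HX i ⊗ HY j)
      ≡⟨ ≡.cong₂ _++_ (shift-⋃₂ x t _) (⋃₂-suc t _) ⟩
    ⋃₂ t (λ i j → shift x (Hx i ⊗ HY j)) ++ (HX 0 ⊗ HY (suc t) ++ ⋃₂ t (λ i j → HX (suc i) ⊗ HY j))
      ↭⟨ shifts (⋃₂ t (λ i j → shift x (Hx i ⊗ HY j))) (HX 0 ⊗ HY (suc t)) ⟩
    HX 0 ⊗ HY (suc t) ++ (⋃₂ t (λ i j → shift x (Hx i ⊗ HY j)) ++ ⋃₂ t (λ i j → HX (suc i) ⊗ HY j))
      ↭⟨ ++⁺ˡ _ (⋃₂-distrib-++ t _ _) ⟨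
    HX 0 ⊗ HY (suc t) ++ ⋃₂ t (λ i j → shift x (Hx i ⊗ HY j) ++ HX (suc i) ⊗ HY j)
      ↭⟨ ++⁺ˡ _ (⋃₂-cong t (λ i j → ↭-trans (↭-reflexive (⊗-++ (shift x (Hx i)) (HX (suc i)) (HY j)))
           (++⁺ʳ _ (shift-⊗ˡ x (Hx i) (HY j))))) ⟨
    Hx 0 ⊗ HY (suc t) ++ ⋃₂ t (λ i j → Hx (suc i) ⊗ HY j)
      ≡⟨ ⋃₂-suc t (λ i j → Hx i ⊗ HY j) ⟨
    ⋃₂ (suc t) (λ i j → Hx i ⊗ HY j) ∎
    where
    Hx = λ i → complete i (x ∷ X)
    HX = λ i → complete i X
    HY = λ j → complete j Y

  prefix : (ℕ → A) → ℕ → List A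
  prefix f k = applyUpTo f (suc k)

  suffix : (ℕ → A) → ℕ → ℕ → List A
  suffix f m k = applyUpTo (λ j → f (k + j)) (suc (m ∸ k))

  pivotSum : ℕ → ℕ → (ℕ → A) → ℕ → List A
  pivotSum a b f m = ⋃ (suc m) (λ k → shift (f k) (complete a (prefix f k) ⊗ complete b (suffix f m k)))

  pivot-head : ∀ a b v L →
    shift v (complete a (v ∷ []) ⊗ complete b (v ∷ L)) ↭ ⋃₂ b (λ i j → shift ((suc a + i) · v) (complete j L))
  pivot-head a b v L = begin
    shift v (complete a (v ∷ []) ⊗ complete b (v ∷ L))      ↭⟨ shift-cong v (⊗-cong (complete-[x] v a) ↭-refl) ⟩
    shift v (((a · v) ∷ []) ⊗ complete b (v ∷ L))           ↭⟨ shift-cong v ([x]⊗ _ _) ⟩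
    shift v (shift (a · v) (complete b (v ∷ L)))            ↭⟨ shift-shift v (a · v) _ ⟩
    shift (suc a · v) (complete b (v ∷ L))                  ↭⟨ shift-cong _ (complete-∷ v L b) ⟩
    shift (suc a · v) (⋃₂ b (λ i j → shift (i · v) (complete j L)))
      ≡⟨ shift-⋃₂ _ b _ ⟩
    ⋃₂ b (λ i j → shift (suc a · v) (shift (i · v) (complete j L)))
      ↭⟨ ⋃₂-cong b (λ i j → ↭-trans (shift-shift _ _ _) (shift-≈ _ (sym (×-homo-+ v (suc a) i)))) ⟩
    ⋃₂ b (λ i j → shift ((suc a + i) · v) (complete j L)) ∎

  pivot-tail : ∀ a b v g m → (∀ j → pivotSum j b g m ↭ complete (j + suc b) (prefix g m)) →
    ⋃ (suc m) (λ k → shift (g k) (complete a (v ∷ prefix g k) ⊗ complete b (suffix g m k)))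
      ↭ ⋃₂ a (λ i j → shift (i · v) (complete (j + suc b) (prefix g m)))
  pivot-tail a b v g m pivot = begin
    ⋃ (suc m) (λ k → shift (g k) (complete a (v ∷ P k) ⊗ S k))
      ↭⟨ ⋃-cong (suc m) (λ k → shift (g k) (complete a (v ∷ P k) ⊗ S k)) _
                (λ k _ → shift-cong (g k) (⊗-cong (complete-∷ v (P k) a) ↭-refl)) ⟩
    ⋃ (suc m) (λ k → shift (g k) (⋃₂ a (λ i j → shift (i · v) (complete j (P k))) ⊗ S k))
      ↭⟨ ⋃-cong (suc m) (λ k → shift (g k) (⋃₂ a (λ i j → shift (i · v) (complete j (P k))) ⊗ S k)) _
                (λ k _ → regroup k) ⟩
    ⋃ (suc m) (λ k → ⋃₂ a (λ i j → shift (i · v) (shift (g k) (complete j (P k) ⊗ S k))))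
      ↭⟨ ⋃-⋃₂ (suc m) a (λ k i j → shift (i · v) (shift (g k) (complete j (P k) ⊗ S k))) ⟩
    ⋃₂ a (λ i j → ⋃ (suc m) (λ k → shift (i · v) (shift (g k) (complete j (P k) ⊗ S k))))
      ↭⟨ ⋃₂-cong a (λ i j → ↭-trans (↭-reflexive (≡.sym (shift-⋃ (i · v) (suc m) (λ k → shift (g k) (complete j (P k) ⊗ S k)))))
                                     (shift-cong (i · v) (pivot j))) ⟩
    ⋃₂ a (λ i j → shift (i · v) (complete (j + suc b) (prefix g m))) ∎
    where
    P = prefix g
    S = λ k → complete b (suffix g m k)
    regroup : ∀ k → shift (g k) (⋃₂ a (λ i j → shift (i · v) (complete j (P k))) ⊗ S k)
                      ↭ ⋃₂ a (λ i j → shift (i · v) (shift (g k) (complete j (P k) ⊗ S k)))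
    regroup k = begin
      shift (g k) (⋃₂ a (λ i j → shift (i · v) (complete j (P k))) ⊗ S k)
        ≡⟨ ≡.cong (shift (g k)) (⋃₂-⊗ a _ (S k)) ⟩
      shift (g k) (⋃₂ a (λ i j → shift (i · v) (complete j (P k)) ⊗ S k))
        ≡⟨ shift-⋃₂ (g k) a _ ⟩
      ⋃₂ a (λ i j → shift (g k) (shift (i · v) (complete j (P k)) ⊗ S k))
        ↭⟨ ⋃₂-cong a (λ i j → ↭-trans (shift-cong (g k) (shift-⊗ˡ (i · v) (complete j (P k)) (S k)))
                                       (shift-comm (g k) (i · v) _)) ⟩
      ⋃₂ a (λ i j → shift (i · v) (shift (g k) (complete j (P k) ⊗ S k))) ∎

  -- Listing a size-(a + 1 + b) submultiset of f 0, …, f m by increasing index, its (a + 1)-st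
  -- element f k is a pivot: a elements before it from f 0, …, f k and b after it from f k, …, f m.
  complete-pivot : ∀ m a b f → pivotSum a b f m ↭ complete (a + suc b) (prefix f m)
  complete-pivot zero a b f = begin
    shift v (complete a (v ∷ []) ⊗ complete b (v ∷ [])) ++ []   ≡⟨ ListP.++-identityʳ _ ⟩
    shift v (complete a (v ∷ []) ⊗ complete b (v ∷ []))         ↭⟨ shift-cong v (⊗-cong (complete-[x] v a) (complete-[x] v b)) ⟩
    shift v (((a · v) ∷ []) ⊗ ((b · v) ∷ []))                    ↭⟨ Perm.refl (sum Pointwise.∷ Pointwise.[]) ⟩
    ((a + suc b) · v) ∷ []                                       ↭⟨ complete-[x] v (a + suc b) ⟨
    complete (a + suc b) (v ∷ [])                                ∎
    where
    v = f 0
    sum : v ∙ ((a · v) ∙ (b · v)) ≈ (a + suc b) · v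
    sum = trans (sym (assoc _ _ _)) (trans (∙-congʳ (comm _ _)) (trans (assoc _ _ _) (sym (×-homo-+ v a (suc b)))))
  complete-pivot (suc m) a b f = begin
    pivotSum a b f (suc m)
      ↭⟨ ++⁺ (pivot-head a b v L) (pivot-tail a b v g m (λ j → complete-pivot m j b g)) ⟩
    ⋃₂ b (λ i j → shift ((suc a + i) · v) (complete j L)) ++ ⋃₂ a (λ i j → shift (i · v) (complete (j + suc b) L))
      ↭⟨ ++-comm (⋃₂ b (λ i j → shift ((suc a + i) · v) (complete j L))) _ ⟩
    ⋃₂ a (λ i j → shift (i · v) (complete (j + suc b) L)) ++ ⋃₂ b (λ i j → shift ((suc a + i) · v) (complete j L))
      ↭⟨ ⋃₂-split a b (λ i j → shift (i · v) (complete j L)) ⟨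
    ⋃₂ (a + suc b) (λ i j → shift (i · v) (complete j L))
      ↭⟨ complete-∷ v L (a + suc b) ⟨
    complete (a + suc b) (v ∷ L) ∎
    where
    v = f 0
    g = λ k → f (suc k)
    L = prefix g m

  ×ε≈ε : ∀ n → n · ε ≈ ε
  ×ε≈ε zero    = refl
  ×ε≈ε (suc n) = trans (identityˡ _) (×ε≈ε n)

  mix : A → A → ℕ → (ℕ → ℕ → List A) → List A
  mix p q j F = ⋃₂ j (λ c d → shift ((c · p) ∙ (d · q)) (F c d))

  -- The ignored index counts copies of the weight ε of gap 0 of a child.
  spread : A → A → ℕ → (ℕ → ℕ → List A) → List A
  spread p q t F = ⋃₂ t (λ _ j → mix p q j F)

  -- K t stands for hₜ of the gap weights of a matching (see ⋃-shift-complete-childGaps).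
  descend : A → A → (ℕ → List A) → ℕ → List A
  descend p q K t = spread p q t (λ c d → K (c + suc d))

  descendants : A → A → ℕ → (ℕ → List A) → List A
  descendants p q zero    K = K 0
  descendants p q (suc l) K = descendants p q l (descend p q K)

  mix-cong : ∀ p q j {F F′} → (∀ c d → F c d ↭ F′ c d) → mix p q j F ↭ mix p q j F′
  mix-cong p q j F↭F′ = ⋃₂-cong j (λ c d → shift-cong _ (F↭F′ c d))

  spread-cong : ∀ p q t {F F′} → (∀ c d → F c d ↭ F′ c d) → spread p q t F ↭ spread p q t F′
  spread-cong p q t F↭F′ = ⋃₂-cong t (λ _ j → mix-cong p q j F↭F′)

  descendants-cong : ∀ p q l {K K′} → (∀ t → K t ↭ K′ t) → descendants p q l K ↭ descendants p q l K′
  descendants-cong p q zero    K↭K′ = K↭K′ 0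
  descendants-cong p q (suc l) K↭K′ = descendants-cong p q l (λ t → spread-cong p q t (λ c d → K↭K′ (c + suc d)))

  ⋃-shift-mix : ∀ p q j n (w : ℕ → A) (F : ℕ → ℕ → ℕ → List A) →
    ⋃ n (λ k → shift (w k) (mix p q j (F k))) ↭ mix p q j (λ c d → ⋃ n (λ k → shift (w k) (F k c d)))
  ⋃-shift-mix p q j n w F = begin
    ⋃ n (λ k → shift (w k) (mix p q j (F k)))
      ↭⟨ ⋃-cong n _ (λ k → mix p q j (λ c d → shift (w k) (F k c d))) (λ k _ →
           ↭-trans (↭-reflexive (shift-⋃₂ (w k) j _)) (⋃₂-cong j (λ c d → shift-comm (w k) _ (F k c d)))) ⟩
    ⋃ n (λ k → mix p q j (λ c d → shift (w k) (F k c d)))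
      ↭⟨ ⋃-⋃₂ n j (λ k c d → shift ((c · p) ∙ (d · q)) (shift (w k) (F k c d))) ⟩
    ⋃₂ j (λ c d → ⋃ n (λ k → shift ((c · p) ∙ (d · q)) (shift (w k) (F k c d))))
      ≡⟨ ListP.concatMap-cong (λ (c , d) → shift-⋃ ((c · p) ∙ (d · q)) n (λ k → shift (w k) (F k c d)))
                              (antidiagonal j) ⟨
    mix p q j (λ c d → ⋃ n (λ k → shift (w k) (F k c d))) ∎

  ⋃-shift-spread : ∀ p q t n (w : ℕ → A) (F : ℕ → ℕ → ℕ → List A) →
    ⋃ n (λ k → shift (w k) (spread p q t (F k))) ↭ spread p q t (λ c d → ⋃ n (λ k → shift (w k) (F k c d)))
  ⋃-shift-spread p q t n w F = begin
    ⋃ n (λ k → shift (w k) (spread p q t (F k)))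
      ↭⟨ ⋃-cong n (λ k → shift (w k) (spread p q t (F k))) _ (λ k _ → ↭-reflexive (shift-⋃₂ (w k) t _)) ⟩
    ⋃ n (λ k → ⋃₂ t (λ _ j → shift (w k) (mix p q j (F k))))
      ↭⟨ ⋃-⋃₂ n t (λ k _ j → shift (w k) (mix p q j (F k))) ⟩
    ⋃₂ t (λ _ j → ⋃ n (λ k → shift (w k) (mix p q j (F k))))
      ↭⟨ ⋃₂-cong t (λ _ j → ⋃-shift-mix p q j n w F) ⟩
    spread p q t (λ c d → ⋃ n (λ k → shift (w k) (F k c d))) ∎

  ⋃-shift-descendants : ∀ p q l n (w : ℕ → A) (K : ℕ → ℕ → List A) →
    ⋃ n (λ k → shift (w k) (descendants p q l (K k))) ↭ descendants p q l (λ t → ⋃ n (λ k → shift (w k) (K k t)))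
  ⋃-shift-descendants p q zero    n w K = ↭-refl
  ⋃-shift-descendants p q (suc l) n w K = ↭-trans (⋃-shift-descendants p q l n w (λ k → descend p q (K k)))
    (descendants-cong p q l (λ t → ⋃-shift-spread p q t n w (λ k c d → K k (c + suc d))))

  descend-comm : ∀ p q K t → descend p q K t ↭ descend q p K t
  descend-comm p q K t = ⋃₂-cong t (λ _ j → ↭-trans (⋃₂-flip j _) (⋃₂-cong j (λ c d → ↭-trans
    (shift-≈ _ (comm (d · p) (c · q)))
    (↭-reflexive (≡.cong (λ e → shift ((c · q) ∙ (d · p)) (K e)) (+-suc-comm d c))))))
    where
    +-suc-comm : ∀ m n → m + suc n ≡ n + suc m
    +-suc-comm m n = ≡.trans (ℕP.+-suc m n) (≡.trans (≡.cong suc (ℕP.+-comm m n)) (≡.sym (ℕP.+-suc n m)))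

  descendants-comm : ∀ p q l K → descendants p q l K ↭ descendants q p l K
  descendants-comm p q zero    K = ↭-refl
  descendants-comm p q (suc l) K = ↭-trans (descendants-cong p q l (descend-comm p q K)) (descendants-comm p q l _)

  descendants-1 : ∀ p q K → descendants p q 1 K ↭ K 1
  descendants-1 p q K = begin
    (shift ((0 · p) ∙ (0 · q)) (K 1) ++ []) ++ []   ≡⟨ ≡.trans (ListP.++-identityʳ _) (ListP.++-identityʳ _) ⟩
    shift ((0 · p) ∙ (0 · q)) (K 1)                 ↭⟨ shift-≈ (K 1) (identityˡ ε) ⟩
    shift ε (K 1)                                   ↭⟨ shift-ε (K 1) ⟩
    K 1                                             ∎

  complete-ε∷ : ∀ t L → complete t (ε ∷ L) ↭ ⋃₂ t (λ _ j → complete j L)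
  complete-ε∷ t L = ↭-trans (complete-∷ ε L t) (⋃₂-cong t (λ i j → ↭-trans (shift-≈ _ (×ε≈ε i)) (shift-ε _)))

  complete-shift-++-shift : ∀ p q P S j →
    complete j (shift p P ++ shift q S) ↭ mix p q j (λ c d → complete c P ⊗ complete d S)
  complete-shift-++-shift p q P S j = ↭-trans (complete-++ (shift p P) (shift q S) j) (⋃₂-cong j (λ c d →
    ↭-trans (⊗-cong (complete-shift p c P) (complete-shift q d S)) (shift-⊗ (c · p) (d · q) (complete c P) (complete d S))))

  childGaps : A → A → (ℕ → A) → ℕ → ℕ → List A
  childGaps p q f m k = ε ∷ (shift p (prefix f k) ++ shift q (suffix f m k))

  ⋃-shift-complete-childGaps : ∀ p q f m t →
    ⋃ (suc m) (λ k → shift (f k) (complete t (childGaps p q f m k))) ↭ descend p q (λ u → complete u (prefix f m)) t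
  ⋃-shift-complete-childGaps p q f m t = begin
    ⋃ (suc m) (λ k → shift (f k) (complete t (childGaps p q f m k)))
      ↭⟨ ⋃-cong (suc m) _ (λ k → shift (f k) (spread p q t (λ c d → complete c (prefix f k) ⊗ complete d (suffix f m k))))
           (λ k _ → shift-cong (f k) (↭-trans (complete-ε∷ t _) (⋃₂-cong t (λ _ j → complete-shift-++-shift p q _ _ j)))) ⟩
    ⋃ (suc m) (λ k → shift (f k) (spread p q t (λ c d → complete c (prefix f k) ⊗ complete d (suffix f m k))))
      ↭⟨ ⋃-shift-spread p q t (suc m) f (λ k c d → complete c (prefix f k) ⊗ complete d (suffix f m k)) ⟩
    spread p q t (λ c d → pivotSum c d f m)
      ↭⟨ spread-cong p q t (λ c d → complete-pivot m c d f) ⟩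
    descend p q (λ u → complete u (prefix f m)) t ∎

-- The statistic along 𝓣(M,l)

module _ {c ℓ : Level} (G : AbelianGroup c ℓ) where

  open AbelianGroup G renaming (Carrier to A)
  open RawMonoidDefs rawMonoid using () renaming (_×_ to _·_)
  open MultP monoid using (×-homo-+)
  open CommSemigroupP commutativeSemigroup using (interchange)
  open PermS setoid using (_↭_; ↭-trans; module PermutationReasoning)
  open PermSP setoid using (Any-resp-↭)
  open Multisets G
  open PermutationReasoning

  gapWeight : A → A → Matching → ℕ → A
  gapWeight α β M k = (spanning k M · α) ∙ (closedBy k M · β)

  s-childAt : ∀ α β k {M} → All ValidEdge M → s G α β (childAt k M) ≈ s G α β M ∙ gapWeight α β M k
  s-childAt α β k {M} valid rewrite cr-childAt k valid | ne-childAt k valid =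
    trans (∙-cong (×-homo-+ α (spanning k M) (cr M)) (×-homo-+ β (closedBy k M) (ne M)))
          (trans (interchange _ _ _ _) (comm _ _))

  applyUpTo-≈ : ∀ (g h : ℕ → A) n → (∀ i → i < n → g i ≈ h i) → Pointwise.Pointwise _≈_ (applyUpTo g n) (applyUpTo h n)
  applyUpTo-≈ g h zero    g≈h = Pointwise.[]
  applyUpTo-≈ g h (suc n) g≈h = g≈h 0 (s≤s z≤n) Pointwise.∷ applyUpTo-≈ (g ∘ suc) (h ∘ suc) n (λ i i<n → g≈h (suc i) (s≤s i<n))

  gapWeights-childAt : ∀ α β {k m} M → k ≤ m →
    prefix (gapWeight α β (childAt k M)) (2 + m) ↭ childGaps α β (gapWeight α β M) m k
  gapWeights-childAt α β {k} {m} M k≤m = Perm.refl (first Pointwise.∷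
    ≡.subst₂ (Pointwise.Pointwise _≈_) (≡.sym split) (≡.sym (≡.cong₂ _++_ (ListP.map-applyUpTo f (α ∙_) (suc k))
                                                                       (ListP.map-applyUpTo (λ j → f (k + j)) (β ∙_) (suc (m ∸ k)))))
      (Pointwise.++⁺ (applyUpTo-≈ _ _ (suc k) (λ i i<1+k → below i (ℕP.≤-pred i<1+k)))
                     (applyUpTo-≈ _ _ (suc (m ∸ k)) (λ j _ → above j))))
    where
    f = gapWeight α β M
    g = gapWeight α β (childAt k M)
    first : g 0 ≈ ε
    first rewrite spanning-childAt-0 k M | closedBy-childAt-0 k M = identityˡ ε
    split : applyUpTo (g ∘ suc) (suc (suc m)) ≡ applyUpTo (g ∘ suc) (suc k) ++ applyUpTo (λ j → g (2 + (k + j))) (suc (m ∸ k))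
    split = ≡.trans (≡.cong (applyUpTo (g ∘ suc)) (≡.cong suc (≡.trans (≡.cong suc (≡.sym (ℕP.m+[n∸m]≡n k≤m))) (≡.sym (ℕP.+-suc k (m ∸ k))))))
                    (applyUpTo-++ (g ∘ suc) (suc k) (suc (m ∸ k)))
    below : ∀ i → i ≤ k → g (suc i) ≈ α ∙ f i
    below i i≤k rewrite spanning-childAt-below M i≤k | closedBy-childAt-below M i≤k = assoc _ _ _
    above : ∀ j → g (2 + (k + j)) ≈ β ∙ f (k + j)
    above j rewrite spanning-childAt-above M (ℕP.m≤m+n k j) | closedBy-childAt-above M (ℕP.m≤m+n k j) =
      trans (∙-congˡ (comm β _)) (trans (sym (assoc _ _ _)) (comm _ β))

  gapWeights : A → A → ℕ → Matching → List A
  gapWeights α β n M = prefix (gapWeight α β M) (2 * n)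

  descendants-childAt : ∀ α β l n k {M} → All ValidEdge M → k ≤ 2 * n →
    shift (s G α β (childAt k M)) (descendants α β l (λ t → complete t (gapWeights α β (suc n) (childAt k M))))
      ↭ shift (s G α β M) (shift (gapWeight α β M k) (descendants α β l (λ t → complete t (childGaps α β (gapWeight α β M) (2 * n) k))))
  descendants-childAt α β l n k {M} valid k≤2n = begin
    shift (s G α β C) (D (gapWeights α β (suc n) C))
      ≡⟨ ≡.cong (λ m → shift (s G α β C) (D (prefix (gapWeight α β C) m))) (ℕP.*-suc 2 n) ⟩
    shift (s G α β C) (D (prefix (gapWeight α β C) (2 + 2 * n)))
      ↭⟨ shift-≈ _ (s-childAt α β k valid) ⟩
    shift (s G α β M ∙ f k) (D (prefix (gapWeight α β C) (2 + 2 * n)))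
      ↭⟨ shift-cong _ (descendants-cong α β l (complete-resp-↭ (gapWeights-childAt α β M k≤2n))) ⟩
    shift (s G α β M ∙ f k) (D (childGaps α β f (2 * n) k))
      ↭⟨ shift-shift (s G α β M) (f k) _ ⟨
    shift (s G α β M) (shift (f k) (D (childGaps α β f (2 * n) k))) ∎
    where
    C = childAt k M
    f = gapWeight α β M
    D = λ L → descendants α β l (λ t → complete t L)

  sImage-tree : ∀ α β l n M → All ValidEdge M →
    map (s G α β) (tree n M l) ↭ shift (s G α β M) (descendants α β l (λ t → complete t (gapWeights α β n M)))
  sImage-tree α β zero    n M valid = Perm.refl (sym (identityʳ _) Pointwise.∷ Pointwise.[])
  sImage-tree α β (suc l) n M valid = begin
    map sα,β (tree n M (suc l))
      ≡⟨ ≡.cong (map sα,β) (tree-suc n M l) ⟩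
    map sα,β (concatMap (λ C → tree (suc n) C l) (children n M))
      ≡⟨ ListP.map-concatMap sα,β (λ C → tree (suc n) C l) (children n M) ⟩
    concatMap (λ C → map sα,β (tree (suc n) C l)) (children n M)
      ≡⟨ ≡.cong (concatMap (λ C → map sα,β (tree (suc n) C l))) (children≡applyUpTo n M) ⟩
    concatMap (λ C → map sα,β (tree (suc n) C l)) (applyUpTo (λ k → childAt k M) (suc m))
      ≡⟨ ≡.cong concat (ListP.map-applyUpTo (λ k → childAt k M) (λ C → map sα,β (tree (suc n) C l)) (suc m)) ⟩
    ⋃ (suc m) (λ k → map sα,β (tree (suc n) (childAt k M) l))
      ↭⟨ ⋃-cong (suc m) _ (λ k → shift sM (shift (f k) (D k))) (λ k k<1+m →
           ↭-trans (sImage-tree α β l (suc n) (childAt k M) (All-ValidEdge-childAt k valid))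
                   (descendants-childAt α β l n k valid (ℕP.≤-pred k<1+m))) ⟩
    ⋃ (suc m) (λ k → shift sM (shift (f k) (D k)))
      ≡⟨ shift-⋃ sM (suc m) (λ k → shift (f k) (D k)) ⟨
    shift sM (⋃ (suc m) (λ k → shift (f k) (D k)))
      ↭⟨ shift-cong sM (⋃-shift-descendants α β l (suc m) f (λ k t → complete t (childGaps α β f m k))) ⟩
    shift sM (descendants α β l (λ t → ⋃ (suc m) (λ k → shift (f k) (complete t (childGaps α β f m k)))))
      ↭⟨ shift-cong sM (descendants-cong α β l (⋃-shift-complete-childGaps α β f m)) ⟩
    shift sM (descendants α β (suc l) (λ t → complete t (gapWeights α β n M))) ∎
    where
    sα,β = s G α β
    sM = s G α β M
    m = 2 * n
    f = gapWeight α β M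
    D = λ k → descendants α β l (λ t → complete t (childGaps α β f m k))

  sImage-𝓣 : ∀ α β n {M} → IsMatching n M → ∀ l →
    sImage G α β (𝓣 n M l) ↭ shift (s G α β M) (descendants α β l (λ t → complete t (gapWeights α β n M)))
  sImage-𝓣 α β n {M} M∈𝓜 l rewrite 𝓣≡tree n M l = sImage-tree α β l n M (IsMatching⇒All-ValidEdge {n} M∈𝓜)

  [x]↭[y]⇒x≈y : ∀ {x y} → (x ∷ []) ↭ (y ∷ []) → x ≈ y
  [x]↭[y]⇒x≈y [x]↭[y] with Any-resp-↭ (λ y≈z x≈y → trans x≈y y≈z) [x]↭[y] (here refl)
  ... | here x≈y = x≈y

  sImage-𝓣-determined : ∀ α β α′ β′ n {M N} → IsMatching n M → IsMatching n N →
    (∀ l K → descendants α β l K ↭ descendants α′ β′ l K) →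
    (∀ l → l ≤ 1 → sImage G α β (𝓣 n M l) ↭ sImage G α′ β′ (𝓣 n N l)) →
    ∀ l → sImage G α β (𝓣 n M l) ↭ sImage G α′ β′ (𝓣 n N l)
  sImage-𝓣-determined α β α′ β′ n {M} {N} M∈𝓜 N∈𝓜 descendants≈ agree l = begin
    sImage G α β (𝓣 n M l)                                     ↭⟨ sImage-𝓣 α β n M∈𝓜 l ⟩
    shift sM (descendants α β l (λ t → complete t gapsM))      ↭⟨ shift-cong sM (descendants-cong α β l (complete-resp-↭ gapsM↭gapsN)) ⟩
    shift sM (descendants α β l (λ t → complete t gapsN))      ↭⟨ shift-cong sM (descendants≈ l _) ⟩
    shift sM (descendants α′ β′ l (λ t → complete t gapsN))    ↭⟨ shift-≈ _ sM≈sN ⟩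
    shift sN (descendants α′ β′ l (λ t → complete t gapsN))    ↭⟨ sImage-𝓣 α′ β′ n N∈𝓜 l ⟨
    sImage G α′ β′ (𝓣 n N l)                                   ∎
    where
    sM = s G α β M
    sN = s G α′ β′ N
    gapsM = gapWeights α β n M
    gapsN = gapWeights α′ β′ n N
    sM≈sN : sM ≈ sN
    sM≈sN = [x]↭[y]⇒x≈y (agree 0 z≤n)
    generation-1 : ∀ p q X → IsMatching n X → sImage G p q (𝓣 n X 1) ↭ shift (s G p q X) (gapWeights p q n X)
    generation-1 p q X X∈𝓜 = ↭-trans (sImage-𝓣 p q n X∈𝓜 1)
      (shift-cong _ (↭-trans (descendants-1 p q (λ t → complete t (gapWeights p q n X))) (complete-1 _)))
    gapsM↭gapsN : gapsM ↭ gapsN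
    gapsM↭gapsN = shift-cancel sM (begin
      shift sM gapsM              ↭⟨ generation-1 α β M M∈𝓜 ⟨
      sImage G α β (𝓣 n M 1)      ↭⟨ agree 1 ℕP.≤-refl ⟩
      sImage G α′ β′ (𝓣 n N 1)    ↭⟨ generation-1 α′ β′ N N∈𝓜 ⟩
      shift sN gapsN              ↭⟨ shift-≈ gapsN sM≈sN ⟨
      shift sM gapsN              ∎)

theorem1p1 : ∀ {c ℓ} (G : AbelianGroup c ℓ) (α β : AbelianGroup.Carrier G)
    (n : ℕ) (M N : Matching) → IsMatching n M → IsMatching n N →
    ((∀ l → l ≤ 1 → _≡ₘ_ G (sImage G α β (𝓣 n M l)) (sImage G α β (𝓣 n N l))) →
      ∀ l → _≡ₘ_ G (sImage G α β (𝓣 n M l)) (sImage G α β (𝓣 n N l)))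
    ×
    ((∀ l → l ≤ 1 → _≡ₘ_ G (sImage G α β (𝓣 n M l)) (sImage G β α (𝓣 n N l))) →
      ∀ l → _≡ₘ_ G (sImage G α β (𝓣 n M l)) (sImage G β α (𝓣 n N l)))
theorem1p1 G α β n M N M∈𝓜 N∈𝓜 =
  sImage-𝓣-determined G α β α β n M∈𝓜 N∈𝓜 (λ _ _ → PermS.↭-refl (AbelianGroup.setoid G)) ,
  sImage-𝓣-determined G α β β α n M∈𝓜 N∈𝓜 (Multisets.descendants-comm G α β)
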